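{- Let $k\ge3$, $b\in\mathbb N$, and let $G$ be an $r$-regular $k$-partite $k$-graph. Then for every partition class $Z$ and every $S\in\mathcal P_{Z,b}$, we have $w(S)\le\gamma_k^{ -m_{Z,b}(|S|)}$.
   Context: A $k$-graph is a hypergraph each of whose edges has exactly $k$ vertices; $k$-partite means the vertex set is partitioned into $k$ partition classes with every edge containing exactly one vertex of each class; $r$-regular means every vertex lies in exactly $r$ edges. An independent set is a vertex set containing no edge; $\mathcal I(\cdot)$ is the set of independent sets. $N_G(S):=\big(\bigcup_{e\in E(G),\,e\cap S\ne\emptyset}e\big)\setminus S$. $\gamma_k:=\frac{2^{k-1}}{2^{k-1}-1}$. For a partition class $Z$, $Z_2$ is the graph on $Z$ with distinct $v,u$ adjacent iff $N_G(\{v\})\cap N_G(\{u\})\ne\emptyset$; a nonempty $S\subseteq Z$ is $2$-linked if $Z_2[S]$ is connected. The link graph $L_G(S)$ is the $(k-1)$-graph on $N_G(S)$ with edges $\{e\setminus S: e\in E(G),\ e\cap S\ne\emptyset\}$. $\mathcal P_{Z,b}:=\{S\subset Z: S\text{ 2-linked},\ 1\le|S|\le b\}$, $w(S):=|\mathcal I(L_G(S))|\cdot 2^{ -|N_G(S)|}$. $m(S)$ is the number of edges in a maximum matching of $L_G(S)$, and for $s\in\mathbb N$, $m_{Z,b}(s):=\min\{m(S): S\in\mathcal P_{Z,b},\ |S|=s\}$. -}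

module Defs where

open import Data.Nat using (ℕ; zero; suc; _+_; _*_; _∸_; _^_; _≤_)
open import Data.Fin using (Fin; _≟_)
open import Data.Fin.Subset using (Subset; inside; outside; _∈_; _∉_; _⊆_; ∣_∣; ⁅_⁆; Nonempty)
open import Data.Fin.Subset.Properties using (_∈?_; _⊆?_)
open import Data.Vec using (Vec; []; _∷_; lookup; tabulate)
import Data.Vec.Membership.Propositional as VM
import Data.Vec.Membership.DecPropositional as VMD
open import Data.Vec.Relation.Unary.Any as VAny using ()
open import Data.Vec.Relation.Unary.All as VAll using ()
open import Data.List using (List; []; _∷_; [_]; map; _++_; length; filter)
open import Data.List.Membership.Propositional as LM using ()
open import Data.List.Relation.Unary.All as LAll using ()
open import Data.List.Relation.Unary.Any as LAny using ()
open import Data.List.Relation.Unary.AllPairs using (AllPairs)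
open import Data.List.Relation.Unary.Unique.Propositional using (Unique)
open import Data.Product using (Σ; ∃; _×_; _,_)
open import Data.Sum using (_⊎_)
open import Relation.Nullary using (¬_; Dec; does)
open import Relation.Nullary.Decidable using (_×-dec_; _⊎-dec_; ¬?)
open import Relation.Binary.PropositionalEquality using (_≡_; _≢_)

-- Vertex set Fin n.  An edge is a k-tuple of vertices: position i is the
-- vertex in partition class i.
Edge : ℕ → ℕ → Set
Edge k n = Vec (Fin n) k

_∈ₑ_ : ∀ {k n} → Fin n → Edge k n → Set
v ∈ₑ e = v VM.∈ e

_∈ₑ?_ : ∀ {k n} (v : Fin n) (e : Edge k n) → Dec (v ∈ₑ e)
v ∈ₑ? e = VMD._∈?_ _≟_ v e

record KPartiteKGraph (k n : ℕ) : Set where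
  field
    part    : Fin n → Fin k
    edges   : List (Edge k n)
    unique  : Unique edges
    partite : LAll.All (λ e → ∀ i → part (lookup e i) ≡ i) edges
open KPartiteKGraph public

degree : ∀ {k n} → KPartiteKGraph k n → Fin n → ℕ
degree G v = length (filter (v ∈ₑ?_) (edges G))

Regular : ∀ {k n} → ℕ → KPartiteKGraph k n → Set
Regular r G = ∀ v → degree G v ≡ r

Meets : ∀ {k n} → Edge k n → Subset n → Set
Meets e S = VAny.Any (_∈ S) e

Meets? : ∀ {k n} (e : Edge k n) (S : Subset n) → Dec (Meets e S)
Meets? e S = VAny.any? (_∈? S) e

-- N_G(S) = (⋃ {e ∈ E : e ∩ S ≠ ∅}) \ S
Nbhd : ∀ {k n} → KPartiteKGraph k n → Subset n → Subset n
Nbhd G S = tabulate λ v →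
  does (¬? (v ∈? S) ×-dec LAny.any? (λ e → Meets? e S ×-dec v ∈ₑ? e) (edges G))

LinkEdgeIn : ∀ {k n} → Edge k n → Subset n → Subset n → Set
LinkEdgeIn e S I = VAll.All (λ v → v ∈ S ⊎ v ∈ I) e

LinkEdgeIn? : ∀ {k n} (e : Edge k n) (S I : Subset n) → Dec (LinkEdgeIn e S I)
LinkEdgeIn? e S I = VAll.all? (λ v → (v ∈? S) ⊎-dec (v ∈? I)) e

-- I is an independent set of the link graph L_G(S): a subset of its vertex
-- set N_G(S) containing no link edge e \ S (e ∈ E, e ∩ S ≠ ∅).
LinkIndependent : ∀ {k n} → KPartiteKGraph k n → Subset n → Subset n → Set
LinkIndependent G S I =
  I ⊆ Nbhd G S × ¬ LAny.Any (λ e → Meets e S × LinkEdgeIn e S I) (edges G)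

LinkIndependent? : ∀ {k n} (G : KPartiteKGraph k n) (S I : Subset n) →
                   Dec (LinkIndependent G S I)
LinkIndependent? G S I =
  (I ⊆? Nbhd G S) ×-dec ¬? (LAny.any? (λ e → Meets? e S ×-dec LinkEdgeIn? e S I) (edges G))

allSubsets : (n : ℕ) → List (Subset n)
allSubsets zero    = [ [] ]
allSubsets (suc n) = map (outside ∷_) (allSubsets n) ++ map (inside ∷_) (allSubsets n)

numIndep : ∀ {k n} → KPartiteKGraph k n → Subset n → ℕ
numIndep G S = length (filter (LinkIndependent? G S) (allSubsets _))

-- A matching of L_G(S), given by a list of edges of G meeting S whose link
-- edges e \ S are pairwise (by list position) disjoint.
DisjointOutside : ∀ {k n} → Subset n → Edge k n → Edge k n → Set
DisjointOutside S e f = ∀ v → v ∈ₑ e → v ∈ₑ f → v ∈ S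

IsLinkMatching : ∀ {k n} → KPartiteKGraph k n → Subset n → List (Edge k n) → Set
IsLinkMatching G S M =
  LAll.All (λ e → e LM.∈ edges G × Meets e S) M × AllPairs (DisjointOutside S) M

IsMatchingNumber : ∀ {k n} → KPartiteKGraph k n → Subset n → ℕ → Set
IsMatchingNumber G S t =
  (Σ (List _) λ M → IsLinkMatching G S M × length M ≡ t) ×
  (∀ M → IsLinkMatching G S M → length M ≤ t)

Adj2 : ∀ {k n} → KPartiteKGraph k n → Fin n → Fin n → Set
Adj2 G v u = v ≢ u × ∃ λ w → w ∈ Nbhd G ⁅ v ⁆ × w ∈ Nbhd G ⁅ u ⁆

data Walk {k n} (G : KPartiteKGraph k n) (S : Subset n) : Fin n → Fin n → Set where
  here : ∀ {u} → Walk G S u u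
  step : ∀ {u w v} → w ∈ S → Adj2 G u w → Walk G S w v → Walk G S u v

TwoLinked : ∀ {k n} → KPartiteKGraph k n → Subset n → Set
TwoLinked G S = Nonempty S × (∀ u v → u ∈ S → v ∈ S → Walk G S u v)

-- S ⊆ Z, where Z is the partition class with index c
InClass : ∀ {k n} → KPartiteKGraph k n → Fin k → Subset n → Set
InClass G c S = ∀ v → v ∈ S → part G v ≡ c

InP : ∀ {k n} → KPartiteKGraph k n → Fin k → ℕ → Subset n → Set
InP G c b S = InClass G c S × TwoLinked G S × 1 ≤ ∣ S ∣ × ∣ S ∣ ≤ b

IsMinMatching : ∀ {k n} → KPartiteKGraph k n → Fin k → ℕ → ℕ → ℕ → Set
IsMinMatching G c b s t =
  (Σ (Subset _) λ S → InP G c b S × ∣ S ∣ ≡ s × IsMatchingNumber G S t) ×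
  (∀ S t′ → InP G c b S → ∣ S ∣ ≡ s → IsMatchingNumber G S t′ → t ≤ t′)

-- w(S) ≤ γ_k^{-t}, i.e.
-- |I(L_G(S))| · 2^{-|N_G(S)|} ≤ ((2^{k-1} - 1) / 2^{k-1})^t,
-- cleared of denominators.
WeightBound : ∀ {k n} → KPartiteKGraph k n → Subset n → ℕ → Set
WeightBound {k} G S t =
  numIndep G S * (2 ^ (k ∸ 1)) ^ t ≤ (2 ^ (k ∸ 1) ∸ 1) ^ t * 2 ^ ∣ Nbhd G S ∣

{-# OPTIONS --safe #-}
module Submission where

-- Let M be a maximum matching of the link graph L_G(S), so |M| ≥ m_{Z,b}(|S|) by minimality.
-- Each e ∈ M meets S, so its link edge e ∖ S has s_e ≤ k − 1 vertices, all in N_G(S), and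
-- these link edges are pairwise disjoint. An independent set of L_G(S) is a subset of N_G(S)
-- containing none of them; as the link edges are disjoint, the conditions "does not contain
-- e ∖ S" constrain disjoint sets of coordinates, so exactly a fraction ∏ (1 − 2^{−s_e}) of the
-- subsets of N_G(S) satisfies all of them. Since 1 − 2^{−s_e} ≤ 1 − 2^{1−k} = γ_k^{−1}, this
-- gives w(S) ≤ γ_k^{−|M|} ≤ γ_k^{−m_{Z,b}(|S|)}. A maximum matching exists because no edge
-- is repeated in a matching: S lies in one class, so every edge leaves S.

open import Algebra.Properties.CommutativeSemigroup using (interchange)
open import Data.Bool using (Bool; true; false; _∧_; not; if_then_else_; T)
open import Data.Bool.Properties using (∧-identityʳ; ∧-zeroʳ; T-∧; T-≡; T-not-≡)
open import Data.Fin using (Fin; zero; suc; punchIn) renaming (_≟_ to _≟ᶠ_)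
open import Data.Fin.Properties using (punchInᵢ≢i) renaming (all? to allFin?)
open import Data.Fin.Subset using (Subset; inside; outside; _∈_; _∉_; _⊆_; ∣_∣; ⊥; ⁅_⁆; _∪_)
open import Data.Fin.Subset.Properties
  using (_⊆?_; _∈?_; ∉⊥; ∣⊥∣≡0; x∈⁅x⁆; x∈⁅y⁆⇒x≡y; ∣⁅x⁆∣≡1; x∈p∪q⁻; x∈p∪q⁺)
open import Data.List using (List; []; _∷_; length; filter; map; _++_; cartesianProductWith)
open import Data.List.Extrema.Nat using (argmax; argmax-all; f[xs]≤f[argmax])
import Data.List.Membership.DecPropositional as DecMembership
open import Data.List.Membership.Propositional using () renaming (_∈_ to _∈ₗ_)
open import Data.List.Membership.Propositional.Properties using (∈-cartesianProductWith⁺; ∈-filter⁺)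
open import Data.List.Properties using (filter-++; length-++; length-map; length-removeAt′)
open import Data.List.Relation.Unary.All as All using (All; []; _∷_)
open import Data.List.Relation.Unary.All.Properties as All using (all-filter)
import Data.List.Relation.Unary.Any as LAny
open import Data.List.Relation.Unary.AllPairs as AllPairs using (AllPairs; []; _∷_; allPairs?)
import Data.List.Relation.Unary.AllPairs.Properties as AllPairs
open import Data.List.Relation.Unary.Unique.Propositional using (Unique)
open import Data.Nat using (ℕ; zero; suc; _+_; _*_; _∸_; _^_; _≤_; _<_; _≤′_; ≤′-refl; ≤′-step; z≤n; s≤s; NonZero)
open import Data.Nat.Properties
open import Data.Product as Product using (Σ; ∃; _×_; _,_; proj₁)
open import Data.Sum as Sum using (_⊎_; inj₁; inj₂)
open import Data.Vec using (Vec; []; _∷_; _[_]≔_; here; there; lookup)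
open import Data.Vec.Membership.Propositional.Properties using (∈-lookup)
open import Data.Vec.Properties using (lookup⇒[]=; lookup∘tabulate; ≡-dec)
import Data.Vec.Relation.Unary.All.Properties as VAll
import Data.Vec.Relation.Unary.Any as VAny
open import Defs
open import Function using (_∘_; id)
open import Function.Bundles using (Equivalence)
open import Relation.Binary.PropositionalEquality
open import Relation.Nullary using (¬_; Dec; does; yes; no; contradiction)
open import Relation.Nullary.Decidable using (dec-true; dec-false; ¬?; _×-dec_; _→-dec_)
open import Relation.Unary using (Decidable)

private
  variable
    n : ℕ

-- x ≤ (1 − 1/a)^m · y, cleared of denominators
record ShrinkBound (a m x y : ℕ) : Set where
  constructor shrinkBound
  field bound : x * a ^ m ≤ (a ∸ 1) ^ m * y

ShrinkBound-zero : ∀ {a x y} → x ≤ y → ShrinkBound a 0 x y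
ShrinkBound-zero {x = x} {y} x≤y = shrinkBound (subst₂ _≤_ (sym (*-identityʳ x)) (sym (*-identityˡ y)) x≤y)

ShrinkBound-suc : ∀ {a m x y z} → x * a ≤ (a ∸ 1) * y → ShrinkBound a m y z → ShrinkBound a (suc m) x z
ShrinkBound-suc {a} {m} {x} {y} {z} x≤y (shrinkBound y≤z) = shrinkBound (begin
  x * (a * a ^ m)             ≡⟨ sym (*-assoc x a (a ^ m)) ⟩
  x * a * a ^ m               ≤⟨ *-monoˡ-≤ (a ^ m) x≤y ⟩
  (a ∸ 1) * y * a ^ m         ≡⟨ *-assoc (a ∸ 1) y (a ^ m) ⟩
  (a ∸ 1) * (y * a ^ m)       ≤⟨ *-monoʳ-≤ (a ∸ 1) y≤z ⟩
  (a ∸ 1) * ((a ∸ 1) ^ m * z) ≡⟨ sym (*-assoc (a ∸ 1) ((a ∸ 1) ^ m) z) ⟩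
  (a ∸ 1) ^ suc m * z         ∎)
  where open ≤-Reasoning

ShrinkBound-pred : ∀ {a m x y} .{{_ : NonZero a}} → ShrinkBound a (suc m) x y → ShrinkBound a m x y
ShrinkBound-pred {a} {m} {x} {y} (shrinkBound x≤y) = shrinkBound (*-cancelʳ-≤ (x * a ^ m) ((a ∸ 1) ^ m * y) a (begin
  x * a ^ m * a               ≡⟨ *-assoc x (a ^ m) a ⟩
  x * (a ^ m * a)             ≡⟨ cong (x *_) (*-comm (a ^ m) a) ⟩
  x * a ^ suc m               ≤⟨ x≤y ⟩
  (a ∸ 1) ^ suc m * y         ≡⟨ *-assoc (a ∸ 1) ((a ∸ 1) ^ m) y ⟩
  (a ∸ 1) * ((a ∸ 1) ^ m * y) ≤⟨ *-monoˡ-≤ ((a ∸ 1) ^ m * y) (m∸n≤m a 1) ⟩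
  a * ((a ∸ 1) ^ m * y)       ≡⟨ *-comm a ((a ∸ 1) ^ m * y) ⟩
  (a ∸ 1) ^ m * y * a         ∎))
  where open ≤-Reasoning

ShrinkBound-antitone : ∀ {a m t x y} .{{_ : NonZero a}} → t ≤ m → ShrinkBound a m x y → ShrinkBound a t x y
ShrinkBound-antitone t≤m = antitone (≤⇒≤′ t≤m)
  where
  antitone : ∀ {a m t x y} .{{_ : NonZero a}} → t ≤′ m → ShrinkBound a m x y → ShrinkBound a t x y
  antitone ≤′-refl          = id
  antitone (≤′-step t≤′m) = antitone t≤′m ∘ ShrinkBound-pred

ShrinkBound-monoˡ : ∀ {a m x x′ y} → x′ ≤ x → ShrinkBound a m x y → ShrinkBound a m x′ y
ShrinkBound-monoˡ {a} {m} x′≤x (shrinkBound x≤y) = shrinkBound (≤-trans (*-monoˡ-≤ (a ^ m) x′≤x) x≤y)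

2^-ratio-mono : ∀ {s k x y} → s ≤ k → x * 2 ^ s ≤ (2 ^ s ∸ 1) * y → x * 2 ^ k ≤ (2 ^ k ∸ 1) * y
2^-ratio-mono {s} {k} {x} {y} s≤k bound = subst (λ a → x * a ≤ (a ∸ 1) * y) p*q≡2^k (begin
  x * (p * q)               ≡⟨ sym (*-assoc x p q) ⟩
  x * p * q                 ≤⟨ *-monoˡ-≤ q bound ⟩
  (p ∸ 1) * y * q           ≡⟨ *-assoc (p ∸ 1) y q ⟩
  (p ∸ 1) * (y * q)         ≡⟨ cong ((p ∸ 1) *_) (*-comm y q) ⟩
  (p ∸ 1) * (q * y)         ≡⟨ sym (*-assoc (p ∸ 1) q y) ⟩
  (p ∸ 1) * q * y           ≡⟨ cong (_* y) (trans (*-distribʳ-∸ q p 1) (cong (p * q ∸_) (*-identityˡ q))) ⟩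
  (p * q ∸ q) * y           ≤⟨ *-monoˡ-≤ y (∸-monoʳ-≤ (p * q) (m^n>0 2 (k ∸ s))) ⟩
  (p * q ∸ 1) * y           ∎)
  where
  open ≤-Reasoning
  p = 2 ^ s
  q = 2 ^ (k ∸ s)
  p*q≡2^k : p * q ≡ 2 ^ k
  p*q≡2^k = trans (sym (^-distribˡ-+-* 2 s (k ∸ s))) (cong (2 ^_) (m+[n∸m]≡n s≤k))

-- Counting subsets of Fin n

count : (Subset n → Bool) → ℕ
count {zero}  f = if f [] then 1 else 0
count {suc n} f = count (f ∘ (outside ∷_)) + count (f ∘ (inside ∷_))

count-cong : {f g : Subset n → Bool} → (∀ I → f I ≡ g I) → count f ≡ count g
count-cong {zero}  f≗g = cong (λ b → if b then 1 else 0) (f≗g [])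
count-cong {suc n} f≗g = cong₂ _+_ (count-cong (f≗g ∘ (outside ∷_))) (count-cong (f≗g ∘ (inside ∷_)))

count-false : count {n} (λ _ → false) ≡ 0
count-false {zero}  = refl
count-false {suc n} = cong₂ _+_ (count-false {n}) (count-false {n})

count-split : (f g : Subset n → Bool) →
              count f ≡ count (λ I → f I ∧ g I) + count (λ I → f I ∧ not (g I))
count-split {zero} f g with f [] | g []
... | true  | true  = refl
... | true  | false = refl
... | false | _     = refl
count-split {suc n} f g =
  trans (cong₂ _+_ (count-split (f ∘ (outside ∷_)) (g ∘ (outside ∷_)))
                   (count-split (f ∘ (inside ∷_)) (g ∘ (inside ∷_))))
        (interchange +-commutativeSemigroup (half outside id) (half outside not) (half inside id) (half inside not))
  where
  half : Bool → (Bool → Bool) → ℕ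
  half x h = count (λ I → f (x ∷ I) ∧ h (g (x ∷ I)))

count-⊆ : (N : Subset n) → count (λ I → does (I ⊆? N)) ≡ 2 ^ ∣ N ∣
count-⊆ []                    = refl
count-⊆ {suc n} (outside ∷ N) = trans (cong₂ _+_ (count-⊆ N) (count-false {n})) (+-identityʳ _)
count-⊆ (inside ∷ N)          = cong₂ _+_ (count-⊆ N) (trans (count-⊆ N) (sym (+-identityʳ _)))

length-filter-map : ∀ {A B : Set} {P : B → Set} (P? : Decidable P) (g : A → B) xs →
                    length (filter P? (map g xs)) ≡ length (filter (P? ∘ g) xs)
length-filter-map P? g []       = refl
length-filter-map P? g (x ∷ xs) with does (P? (g x))
... | true  = cong suc (length-filter-map P? g xs)
... | false = length-filter-map P? g xs

length-filter-allSubsets≤count : ∀ {P : Subset n → Set} (P? : Decidable P) (f : Subset n → Bool) →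
                                 (∀ I → P I → T (f I)) → length (filter P? (allSubsets n)) ≤ count f
length-filter-allSubsets≤count {zero} P? f P⇒f with P? []
... | no _  = z≤n
... | yes p with f [] | P⇒f [] p
...   | true | _ = ≤-refl
length-filter-allSubsets≤count {suc n} P? f P⇒f = begin
  length (filter P? (map (outside ∷_) subsets ++ map (inside ∷_) subsets))
    ≡⟨ cong length (filter-++ P? (map (outside ∷_) subsets) _) ⟩
  length (filter P? (map (outside ∷_) subsets) ++ filter P? (map (inside ∷_) subsets))
    ≡⟨ length-++ (filter P? (map (outside ∷_) subsets)) ⟩
  length (filter P? (map (outside ∷_) subsets)) + length (filter P? (map (inside ∷_) subsets))
    ≡⟨ cong₂ _+_ (length-filter-map P? _ subsets) (length-filter-map P? _ subsets) ⟩
  length (filter (P? ∘ (outside ∷_)) subsets) + length (filter (P? ∘ (inside ∷_)) subsets)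
    ≤⟨ +-mono-≤ (length-filter-allSubsets≤count _ _ (P⇒f ∘ (outside ∷_)))
                (length-filter-allSubsets≤count _ _ (P⇒f ∘ (inside ∷_))) ⟩
  count f ∎
  where
  open ≤-Reasoning
  subsets = allSubsets n

Ignores : Subset n → (Subset n → Bool) → Set
Ignores B f = ∀ I {i} x → i ∈ B → f (I [ i ]≔ x) ≡ f I

Ignores-∷ : ∀ {y f} {B : Subset n} x → Ignores (y ∷ B) f → Ignores B (f ∘ (x ∷_))
Ignores-∷ x ign I y i∈B = ign (x ∷ I) y (there i∈B)

count-containing : (B : Subset n) (f : Subset n → Bool) → Ignores B f →
                   count (λ I → f I ∧ does (B ⊆? I)) * 2 ^ ∣ B ∣ ≡ count f
count-containing [] f _ = trans (*-identityʳ _) (cong (λ b → if b then 1 else 0) (∧-identityʳ (f [])))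
count-containing (outside ∷ B) f ign =
  trans (*-distribʳ-+ (2 ^ ∣ B ∣) (half outside) (half inside))
        (cong₂ _+_ (count-containing B (f ∘ (outside ∷_)) (Ignores-∷ outside ign))
                   (count-containing B (f ∘ (inside ∷_)) (Ignores-∷ inside ign)))
  where
  half : Bool → ℕ
  half x = count (λ I → f (x ∷ I) ∧ does (B ⊆? I))
count-containing {suc n} (inside ∷ B) f ign = begin
  (count (λ I → f (outside ∷ I) ∧ false) + Y) * (2 * p)
    ≡⟨ cong (λ c → (c + Y) * (2 * p)) (trans (count-cong {n} (λ I → ∧-zeroʳ (f (outside ∷ I)))) (count-false {n})) ⟩
  Y * (2 * p)             ≡⟨ cong (Y *_) (*-comm 2 p) ⟩
  Y * (p * 2)             ≡⟨ sym (*-assoc Y p 2) ⟩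
  Y * p * 2               ≡⟨ cong (_* 2) (count-containing B (f ∘ (inside ∷_)) (Ignores-∷ inside ign)) ⟩
  count fᵢ * 2            ≡⟨ *-comm (count fᵢ) 2 ⟩
  count fᵢ + (count fᵢ + 0)
    ≡⟨ cong₂ _+_ (count-cong (λ I → sym (ign (inside ∷ I) outside here))) (+-identityʳ _) ⟩
  count (f ∘ (outside ∷_)) + count fᵢ ∎
  where
  open ≡-Reasoning
  p = 2 ^ ∣ B ∣
  fᵢ = f ∘ (inside ∷_)
  Y = count (λ I → fᵢ I ∧ does (B ⊆? I))

count-notContaining : (B : Subset n) (f : Subset n → Bool) → Ignores B f →
                      count (λ I → f I ∧ not (does (B ⊆? I))) * 2 ^ ∣ B ∣ ≡ (2 ^ ∣ B ∣ ∸ 1) * count f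
count-notContaining B f ign = begin
  X * p                     ≡⟨ sym (m+n∸n≡m (X * p) (Y * p)) ⟩
  X * p + Y * p ∸ Y * p     ≡⟨ cong₂ _∸_ (sym (*-distribʳ-+ p X Y)) (count-containing B f ign) ⟩
  (X + Y) * p ∸ count f     ≡⟨ cong (λ c → c * p ∸ count f) (trans (+-comm X Y) (sym (count-split f (λ I → does (B ⊆? I))))) ⟩
  count f * p ∸ count f     ≡⟨ cong₂ _∸_ (*-comm (count f) p) (sym (*-identityˡ (count f))) ⟩
  p * count f ∸ 1 * count f ≡⟨ sym (*-distribʳ-∸ (count f) p 1) ⟩
  (p ∸ 1) * count f ∎
  where
  open ≡-Reasoning
  p = 2 ^ ∣ B ∣
  X = count (λ I → f I ∧ not (does (B ⊆? I)))
  Y = count (λ I → f I ∧ does (B ⊆? I))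

Disjoint : Subset n → Subset n → Set
Disjoint p q = ∀ {i} → i ∈ p → i ∉ q

does-⊆?-∷-inside : ∀ x (p q : Subset n) → does ((x ∷ p) ⊆? (inside ∷ q)) ≡ does (p ⊆? q)
does-⊆?-∷-inside outside p q = refl
does-⊆?-∷-inside inside  p q = refl

does-⊆?-updateˡ : (p q : Subset n) {i : Fin n} (x : Bool) → i ∈ q →
                  does ((p [ i ]≔ x) ⊆? q) ≡ does (p ⊆? q)
does-⊆?-updateˡ (y ∷ p) (inside ∷ q) x here =
  trans (does-⊆?-∷-inside x p q) (sym (does-⊆?-∷-inside y p q))
does-⊆?-updateˡ (outside ∷ p) (_ ∷ q)       x (there i∈q) = does-⊆?-updateˡ p q x i∈q
does-⊆?-updateˡ (inside ∷ p)  (inside ∷ q)  x (there i∈q) = does-⊆?-updateˡ p q x i∈q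
does-⊆?-updateˡ (inside ∷ p)  (outside ∷ q) x (there i∈q) = refl

does-⊆?-updateʳ : (p q : Subset n) {i : Fin n} (x : Bool) → i ∉ p →
                  does (p ⊆? (q [ i ]≔ x)) ≡ does (p ⊆? q)
does-⊆?-updateʳ (outside ∷ p) (_ ∷ q) {zero} x i∉p = refl
does-⊆?-updateʳ (inside ∷ p)  (_ ∷ q) {zero} x i∉p = contradiction here i∉p
does-⊆?-updateʳ (outside ∷ p) (_ ∷ q)       {suc i} x i∉p = does-⊆?-updateʳ p q x (i∉p ∘ there)
does-⊆?-updateʳ (inside ∷ p)  (inside ∷ q)  {suc i} x i∉p = does-⊆?-updateʳ p q x (i∉p ∘ there)
does-⊆?-updateʳ (inside ∷ p)  (outside ∷ q) {suc i} x i∉p = refl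

avoiding : Subset n → List (Subset n) → Subset n → Bool
avoiding N []       I = does (I ⊆? N)
avoiding N (B ∷ Bs) I = avoiding N Bs I ∧ not (does (B ⊆? I))

avoiding-ignores : ∀ {B N : Subset n} Bs → B ⊆ N → All (Disjoint B) Bs → Ignores B (avoiding N Bs)
avoiding-ignores {N = N} []  B⊆N []              I x i∈B = does-⊆?-updateˡ I N x (B⊆N i∈B)
avoiding-ignores (B′ ∷ Bs) B⊆N (B#B′ ∷ B#Bs) I x i∈B =
  cong₂ _∧_ (avoiding-ignores Bs B⊆N B#Bs I x i∈B) (cong not (does-⊆?-updateʳ B′ I x (B#B′ i∈B)))

count-avoiding : ∀ {s} (N : Subset n) Bs → All (_⊆ N) Bs → AllPairs Disjoint Bs → All (λ B → ∣ B ∣ ≤ s) Bs →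
                 ShrinkBound (2 ^ s) (length Bs) (count (avoiding N Bs)) (2 ^ ∣ N ∣)
count-avoiding N [] [] [] [] = ShrinkBound-zero (≤-reflexive (count-⊆ N))
count-avoiding N (B ∷ Bs) (B⊆N ∷ Bs⊆N) (B#Bs ∷ disjoint) (∣B∣≤s ∷ ∣Bs∣≤s) =
  ShrinkBound-suc
    (2^-ratio-mono {x = count (avoiding N (B ∷ Bs))} ∣B∣≤s (≤-reflexive
      (count-notContaining B (avoiding N Bs) (avoiding-ignores Bs B⊆N B#Bs))))
    (count-avoiding N Bs Bs⊆N disjoint ∣Bs∣≤s)

-- Link edges

∣p∪q∣≤∣p∣+∣q∣ : (p q : Subset n) → ∣ p ∪ q ∣ ≤ ∣ p ∣ + ∣ q ∣
∣p∪q∣≤∣p∣+∣q∣ []            []            = z≤n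
∣p∪q∣≤∣p∣+∣q∣ (outside ∷ p) (outside ∷ q) = ∣p∪q∣≤∣p∣+∣q∣ p q
∣p∪q∣≤∣p∣+∣q∣ (outside ∷ p) (inside ∷ q)  = ≤-trans (s≤s (∣p∪q∣≤∣p∣+∣q∣ p q)) (≤-reflexive (sym (+-suc _ _)))
∣p∪q∣≤∣p∣+∣q∣ (inside ∷ p)  (outside ∷ q) = s≤s (∣p∪q∣≤∣p∣+∣q∣ p q)
∣p∪q∣≤∣p∣+∣q∣ (inside ∷ p)  (inside ∷ q)  = s≤s (≤-trans (∣p∪q∣≤∣p∣+∣q∣ p q) (+-monoʳ-≤ ∣ p ∣ (n≤1+n ∣ q ∣)))

∣⁅x⁆∪p∣≤1+∣p∣ : (x : Fin n) (p : Subset n) → ∣ ⁅ x ⁆ ∪ p ∣ ≤ suc ∣ p ∣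
∣⁅x⁆∪p∣≤1+∣p∣ x p = ≤-trans (∣p∪q∣≤∣p∣+∣q∣ ⁅ x ⁆ p) (≤-reflexive (cong (_+ ∣ p ∣) (∣⁅x⁆∣≡1 x)))

linkSet : ∀ {m} → Subset n → Vec (Fin n) m → Subset n
linkSet S []      = ⊥
linkSet S (v ∷ e) with v ∈? S
... | yes _ = linkSet S e
... | no  _ = ⁅ v ⁆ ∪ linkSet S e

module _ (S : Subset n) where

  ∈-linkSet⁻ : ∀ {m} (e : Vec (Fin n) m) {v : Fin n} → v ∈ linkSet S e → v ∈ₑ e × v ∉ S
  ∈-linkSet⁻ [] v∈ = contradiction v∈ ∉⊥
  ∈-linkSet⁻ (w ∷ e) v∈ with w ∈? S
  ... | yes _ = Product.map₁ VAny.there (∈-linkSet⁻ e v∈)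
  ... | no w∉S with x∈p∪q⁻ ⁅ w ⁆ (linkSet S e) v∈
  ...   | inj₁ v∈⁅w⁆ rewrite x∈⁅y⁆⇒x≡y w v∈⁅w⁆ = VAny.here refl , w∉S
  ...   | inj₂ v∈L = Product.map₁ VAny.there (∈-linkSet⁻ e v∈L)

  ∈ₑ⇒∈⊎∈linkSet : ∀ {m} (e : Vec (Fin n) m) {v : Fin n} → v ∈ₑ e → v ∈ S ⊎ v ∈ linkSet S e
  ∈ₑ⇒∈⊎∈linkSet (w ∷ e) v∈e with w ∈? S | v∈e
  ... | yes w∈S | VAny.here refl = inj₁ w∈S
  ... | yes _   | VAny.there v∈e′ = ∈ₑ⇒∈⊎∈linkSet e v∈e′
  ... | no _    | VAny.here refl = inj₂ (x∈p∪q⁺ (inj₁ (x∈⁅x⁆ w)))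
  ... | no _    | VAny.there v∈e′ = Sum.map₂ (λ v∈L → x∈p∪q⁺ (inj₂ v∈L)) (∈ₑ⇒∈⊎∈linkSet e v∈e′)

  ∣linkSet∣≤ : ∀ {m} (e : Vec (Fin n) m) → ∣ linkSet S e ∣ ≤ m
  ∣linkSet∣≤ [] = ≤-reflexive (∣⊥∣≡0 n)
  ∣linkSet∣≤ (w ∷ e) with w ∈? S
  ... | yes _ = m≤n⇒m≤1+n (∣linkSet∣≤ e)
  ... | no  _ = ≤-trans (∣⁅x⁆∪p∣≤1+∣p∣ w (linkSet S e)) (s≤s (∣linkSet∣≤ e))

  ∣linkSet∣< : ∀ {m} (e : Vec (Fin n) m) → Meets e S → ∣ linkSet S e ∣ < m
  ∣linkSet∣< (w ∷ e) meets with w ∈? S | meets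
  ... | yes _   | _                 = s≤s (∣linkSet∣≤ e)
  ... | no w∉S  | VAny.here w∈S     = contradiction w∈S w∉S
  ... | no _    | VAny.there meets′ = s≤s (≤-trans (∣⁅x⁆∪p∣≤1+∣p∣ w (linkSet S e)) (∣linkSet∣< e meets′))

  linkSet-disjoint : ∀ {m} {e f : Vec (Fin n) m} → DisjointOutside S e f → Disjoint (linkSet S e) (linkSet S f)
  linkSet-disjoint {e = e} {f} e#f v∈Le v∈Lf with ∈-linkSet⁻ e v∈Le
  ... | v∈e , v∉S = v∉S (e#f _ v∈e (proj₁ (∈-linkSet⁻ f v∈Lf)))

module _ {k n} (G : KPartiteKGraph k n) (S : Subset n) where

  ∈-Nbhd⁺ : ∀ {v} → v ∉ S → LAny.Any (λ e → Meets e S × v ∈ₑ e) (edges G) → v ∈ Nbhd G S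
  ∈-Nbhd⁺ {v} v∉S v∈e∈G = lookup⇒[]= v (Nbhd G S) (trans (lookup∘tabulate _ v)
    (dec-true (¬? (v ∈? S) ×-dec LAny.any? (λ e → Meets? e S ×-dec v ∈ₑ? e) (edges G)) (v∉S , v∈e∈G)))

  linkSet⊆Nbhd : ∀ {e} → e ∈ₗ edges G → Meets e S → linkSet S e ⊆ Nbhd G S
  linkSet⊆Nbhd e∈G meets v∈L with ∈-linkSet⁻ S _ v∈L
  ... | v∈e , v∉S = ∈-Nbhd⁺ v∉S (LAny.map (λ { refl → meets , v∈e }) e∈G)

  linkSet⊈independent : ∀ {e I} → LinkIndependent G S I → e ∈ₗ edges G → Meets e S → ¬ (linkSet S e ⊆ I)
  linkSet⊈independent {e} {I} (_ , noLinkEdge) e∈G meets L⊆I =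
    noLinkEdge (LAny.map (λ { refl → meets , linkEdgeIn }) e∈G)
    where
    linkEdgeIn : LinkEdgeIn e S I
    linkEdgeIn = VAll.lookup⁻ (λ i → Sum.map₂ L⊆I (∈ₑ⇒∈⊎∈linkSet S e (∈-lookup i e)))

  independent⇒avoiding : ∀ {I} M → LinkIndependent G S I → All (λ e → e ∈ₗ edges G × Meets e S) M →
                         T (avoiding (Nbhd G S) (map (linkSet S) M) I)
  independent⇒avoiding []      (I⊆N , _) []                   = Equivalence.from T-≡ (dec-true (_ ⊆? Nbhd G S) I⊆N)
  independent⇒avoiding (e ∷ M) indep     ((e∈G , meets) ∷ ps) =
    Equivalence.from T-∧
      ( independent⇒avoiding M indep ps
      , Equivalence.from T-not-≡ (dec-false (linkSet S e ⊆? _) (linkSet⊈independent indep e∈G meets)))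

  numIndep-bound : ∀ {M} → IsLinkMatching G S M →
                   ShrinkBound (2 ^ (k ∸ 1)) (length M) (numIndep G S) (2 ^ ∣ Nbhd G S ∣)
  numIndep-bound {M} (inG , disjoint) =
    ShrinkBound-monoˡ
      (length-filter-allSubsets≤count (LinkIndependent? G S) (avoiding N Bs)
        (λ _ indep → independent⇒avoiding M indep inG))
      (subst (λ l → ShrinkBound (2 ^ (k ∸ 1)) l (count (avoiding N Bs)) (2 ^ ∣ N ∣))
        (length-map (linkSet S) M)
        (count-avoiding N Bs
          (All.map⁺ (All.map (λ (e∈G , meets) {_} → linkSet⊆Nbhd e∈G meets) inG))
          (AllPairs.map⁺ (AllPairs.map (linkSet-disjoint S) disjoint))
          (All.map⁺ (All.map (λ (_ , meets) → ∸-monoˡ-≤ 1 (∣linkSet∣< S _ meets)) inG))))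
    where
    N = Nbhd G S
    Bs = map (linkSet S) M

-- Maximum matchings

module _ {A : Set} where

  ∈-─⁺ : ∀ {x y : A} {ys} → y ∈ₗ ys → y ≢ x → (x∈ys : x ∈ₗ ys) → y ∈ₗ (ys LAny.─ x∈ys)
  ∈-─⁺ (LAny.here refl) y≢x (LAny.here refl) = contradiction refl y≢x
  ∈-─⁺ (LAny.there y∈ys) _  (LAny.here _)    = y∈ys
  ∈-─⁺ (LAny.here y≡z)  _   (LAny.there _)   = LAny.here y≡z
  ∈-─⁺ (LAny.there y∈ys) y≢x (LAny.there x∈ys) = LAny.there (∈-─⁺ y∈ys y≢x x∈ys)

  Unique⇒length≤ : ∀ {xs ys : List A} → Unique xs → All (_∈ₗ ys) xs → length xs ≤ length ys
  Unique⇒length≤ {[]}     _                 _              = z≤n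
  Unique⇒length≤ {x ∷ xs} {ys} (x∉xs ∷ uniq) (x∈ys ∷ xs⊆ys) = begin
    suc (length xs)                            ≤⟨ s≤s (Unique⇒length≤ uniq xs⊆ys─x) ⟩
    suc (length (ys LAny.─ x∈ys))              ≡⟨ sym (length-removeAt′ ys (LAny.index x∈ys)) ⟩
    length ys ∎
    where
    open ≤-Reasoning
    xs⊆ys─x : All (_∈ₗ (ys LAny.─ x∈ys)) xs
    xs⊆ys─x = All.map (λ (x≢y , y∈ys) → ∈-─⁺ y∈ys (x≢y ∘ sym) x∈ys) (All.zip (x∉xs , xs⊆ys))

  listsOfLength≤ : List A → ℕ → List (List A)
  listsOfLength≤ ys zero    = [] ∷ []
  listsOfLength≤ ys (suc l) = [] ∷ cartesianProductWith _∷_ ys (listsOfLength≤ ys l)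

  ∈-listsOfLength≤ : ∀ {xs ys} l → All (_∈ₗ ys) xs → length xs ≤ l → xs ∈ₗ listsOfLength≤ ys l
  ∈-listsOfLength≤ {[]}     zero    _              _         = LAny.here refl
  ∈-listsOfLength≤ {[]}     (suc l) _              _         = LAny.here refl
  ∈-listsOfLength≤ {x ∷ xs} (suc l) (x∈ys ∷ xs⊆ys) (s≤s ∣xs∣≤l) =
    LAny.there (∈-cartesianProductWith⁺ _∷_ x∈ys (∈-listsOfLength≤ l xs⊆ys ∣xs∣≤l))

  longestWitness : ∀ {P : List A → Set} ys → Decidable P → P [] →
                   (∀ {xs} → P xs → Unique xs × All (_∈ₗ ys) xs) →
                   Σ (List A) λ xs → P xs × (∀ zs → P zs → length zs ≤ length xs)
  longestWitness {P} ys P? P[] bounded =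
    argmax length [] candidates ,
    argmax-all length P[] (all-filter P? (listsOfLength≤ ys (length ys))) ,
    λ zs Pzs → All.lookup (f[xs]≤f[argmax] [] candidates) (∈-filter⁺ P? (candidate Pzs) Pzs)
    where
    candidates = filter P? (listsOfLength≤ ys (length ys))
    candidate : ∀ {zs} → P zs → zs ∈ₗ listsOfLength≤ ys (length ys)
    candidate Pzs with bounded Pzs
    ... | uniq , zs⊆ys = ∈-listsOfLength≤ (length ys) zs⊆ys (Unique⇒length≤ uniq zs⊆ys)

EveryEdgeLeaves : ∀ {k n} → KPartiteKGraph k n → Subset n → Set
EveryEdgeLeaves G S = ∀ {e} → e ∈ₗ edges G → ∃ λ v → v ∈ₑ e × v ∉ S

inClass⇒everyEdgeLeaves : ∀ {k n} (G : KPartiteKGraph (suc (suc k)) n) {c S} → InClass G c S → EveryEdgeLeaves G S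
inClass⇒everyEdgeLeaves G {c} inClass {e} e∈G =
  lookup e d , ∈-lookup d e , λ v∈S → punchInᵢ≢i c zero (trans (sym (All.lookup (partite G) e∈G d)) (inClass _ v∈S))
  where
  d = punchIn c zero

module _ {k n} (G : KPartiteKGraph k n) (S : Subset n) where

  DisjointOutside? : (e f : Edge k n) → Dec (DisjointOutside S e f)
  DisjointOutside? e f = allFin? (λ v → (v ∈ₑ? e) →-dec (v ∈ₑ? f) →-dec (v ∈? S))

  IsLinkMatching? : Decidable (IsLinkMatching G S)
  IsLinkMatching? M =
    All.all? (λ e → (e ∈ₗ? edges G) ×-dec Meets? e S) M ×-dec allPairs? DisjointOutside? M
    where open DecMembership (≡-dec _≟ᶠ_) using () renaming (_∈?_ to _∈ₗ?_)

  linkMatching⇒Unique : EveryEdgeLeaves G S → ∀ {M} → IsLinkMatching G S M → Unique M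
  linkMatching⇒Unique leaves {[]}    _ = []
  linkMatching⇒Unique leaves {e ∷ M} ((e∈G , _) ∷ inG , e#M ∷ disjoint) =
    All.map (λ { e#e refl → selfDisjoint e#e }) e#M ∷ linkMatching⇒Unique leaves (inG , disjoint)
    where
    selfDisjoint : ¬ DisjointOutside S e e
    selfDisjoint e#e with leaves e∈G
    ... | v , v∈e , v∉S = v∉S (e#e v v∈e v∈e)

  matchingNumber : EveryEdgeLeaves G S → ∃ (IsMatchingNumber G S)
  matchingNumber leaves with longestWitness (edges G) IsLinkMatching? ([] , [])
                               (λ isM → linkMatching⇒Unique leaves isM , All.map proj₁ (proj₁ isM))
  ... | M , isM , longest = length M , (M , isM , refl) , longest

lemma5p3 : (k n r b : ℕ) → 3 ≤ k → (G : KPartiteKGraph k n) → Regular r G →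
           (c : Fin k) → (S : Subset n) → InP G c b S →
           (t : ℕ) → IsMinMatching G c b ∣ S ∣ t → WeightBound G S t
lemma5p3 (suc (suc k)) n r b (s≤s (s≤s _)) G _ c S inP@(inClass , _) t (_ , minimal)
  with matchingNumber G S (inClass⇒everyEdgeLeaves G inClass)
... | m , (M , isM , refl) , maximum =
  ShrinkBound.bound (ShrinkBound-antitone {{m^n≢0 2 (suc k)}}
    (minimal S m inP refl ((M , isM , refl) , maximum))
    (numIndep-bound G S isM))
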